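{- Let $G$ be a finite group. The difference graph $\mathrm{D}(G)$ can be reconstructed from the cyclic subgroup lattice $\mathcal{L}_c(G)$. In particular, if $H$ is a finite group with $\mathcal{L}_c(G)\cong\mathcal{L}_c(H)$, then $\mathrm{D}(G)\cong\mathrm{D}(H)$.
   Context: $\mathcal{L}_c(G)$ is the set of cyclic subgroups of $G$ ordered by inclusion, identified with its Hasse diagram, each vertex labelled by the order of the corresponding subgroup; an isomorphism of such lattices is an order-isomorphism preserving these order labels. The enhanced power graph $\mathrm{EPow}(G)$ has vertex set $G$, distinct $x,y$ adjacent iff $\langle x,y\rangle$ is cyclic; the power graph $\mathrm{Pow}(G)$ has vertex set $G$, distinct $x,y$ adjacent iff one is a power of the other. The difference graph $\mathrm{D}(G)$ is the graph with edge set $E(\mathrm{EPow}(G))\setminus E(\mathrm{Pow}(G))$ and all isolated vertices removed. -}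

module Defs where

open import Data.Nat using (ℕ; zero; suc)
open import Data.Fin using (Fin)
open import Data.List using (List; length)
open import Data.List.Membership.Propositional using (_∈_)
open import Data.List.Relation.Unary.Unique.Propositional using (Unique)
open import Data.Product using (Σ; ∃; _×_; _,_)
open import Data.Sum using (_⊎_)
open import Relation.Binary.PropositionalEquality using (_≡_; _≢_)
open import Relation.Nullary using (¬_)

-- A finite group: carrier Fin order, with propositional equality.
-- (Every finite group is isomorphic to one of this form.)
record FinGroup : Set where
  field
    order : ℕ
    _·_   : Fin order → Fin order → Fin order
    e     : Fin order
    inv   : Fin order → Fin order
    assoc : ∀ a b c → (a · b) · c ≡ a · (b · c)
    idˡ   : ∀ a → e · a ≡ a
    idʳ   : ∀ a → a · e ≡ a
    invˡ  : ∀ a → inv a · a ≡ e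
    invʳ  : ∀ a → a · inv a ≡ e

_⟺_ : Set → Set → Set
A ⟺ B = (A → B) × (B → A)

HasSize : {n : ℕ} → (Fin n → Set) → ℕ → Set
HasSize {n} P c =
  Σ (List (Fin n)) λ l → (length l ≡ c) × Unique l × (∀ y → (y ∈ l) ⟺ P y)

module _ (G : FinGroup) where
  open FinGroup G

  El : Set
  El = Fin order

  pow : El → ℕ → El
  pow x zero = e
  pow x (suc k) = x · pow x k

  data Gen (S : El → Set) : El → Set where
    gen-e   : Gen S e
    gen-s   : ∀ {a} → S a → Gen S a
    gen-mul : ∀ {a b} → Gen S a → Gen S b → Gen S (a · b)
    gen-inv : ∀ {a} → Gen S a → Gen S (inv a)

  Cyc : El → El → Set
  Cyc x = Gen (λ w → w ≡ x)

  Gen2 : El → El → El → Set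
  Gen2 x y = Gen (λ w → (w ≡ x) ⊎ (w ≡ y))

  IsCyclic : (El → Set) → Set
  IsCyclic H = ∃ λ z → ∀ w → H w ⟺ Cyc z w

  _⊑_ : El → El → Set
  x ⊑ y = ∀ w → Cyc x w → Cyc y w

  EPowAdj : El → El → Set
  EPowAdj x y = (x ≢ y) × IsCyclic (Gen2 x y)

  PowAdj : El → El → Set
  PowAdj x y = (x ≢ y) × ((∃ λ k → y ≡ pow x k) ⊎ (∃ λ k → x ≡ pow y k))

  DAdj : El → El → Set
  DAdj x y = EPowAdj x y × ¬ PowAdj x y

  -- vertices of D(G): non-isolated vertices
  DVert : El → Set
  DVert x = ∃ λ y → DAdj x y

-- Isomorphism of cyclic subgroup lattices L_c(G) ≅ L_c(H) as labelled posets.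
-- Cyclic subgroups are represented by generators; φ, ψ act on generators.
record LcIso (G H : FinGroup) : Set where
  field
    φ : El G → El H
    ψ : El H → El G
    φ-mono : ∀ x y → _⊑_ G x y ⟺ _⊑_ H (φ x) (φ y)
    ψφ : ∀ x w → Cyc G (ψ (φ x)) w ⟺ Cyc G x w
    φψ : ∀ y w → Cyc H (φ (ψ y)) w ⟺ Cyc H y w
    φ-label : ∀ x c → HasSize (Cyc G x) c ⟺ HasSize (Cyc H (φ x)) c

record DIso (G H : FinGroup) : Set where
  field
    f : El G → El H
    g : El H → El G
    f-vert : ∀ x → DVert G x → DVert H (f x)
    g-vert : ∀ y → DVert H y → DVert G (g y)
    gf : ∀ x → DVert G x → g (f x) ≡ x
    fg : ∀ y → DVert H y → f (g y) ≡ y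
    f-adj : ∀ x y → DVert G x → DVert G y → DAdj G x y ⟺ DAdj H (f x) (f y)

{-# OPTIONS --safe #-}
-- Adjacency in D(G) is a property of the poset of cyclic subgroups: x and y are adjacent
-- iff ⟨x⟩ and ⟨y⟩ are incomparable but lie in a common cyclic subgroup ⟨z⟩, because
-- x = z^a and y = z^b generate ⟨z^gcd(a,b)⟩ (Bézout). So it suffices to lift the lattice
-- isomorphism φ to a bijection f of elements with ⟨f x⟩ = φ⟨x⟩. Choose a canonical
-- generator c of every cyclic subgroup and send c^k to d^k, where d is the canonical
-- generator of φ⟨c⟩: since ord c = ord d, c^k generates ⟨c⟩ iff k is invertible modulo
-- ord c iff d^k generates ⟨d⟩, so this is a bijection from generators to generators.
module Submission where

open import Defs hiding (_⊑_)
open import Algebra.Bundles using (Group)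
open import Algebra.Structures using (IsGroup)
open import Data.Fin using (Fin; toℕ; fromℕ<) renaming (_≤_ to _≤ᶠ_)
import Data.Fin.Properties as Fin
open import Data.List using (tabulate)
open import Data.List.Membership.Propositional using (_∈_)
open import Data.List.Properties using (length-tabulate)
open import Data.List.Membership.Propositional.Properties using (∈-tabulate⁺; ∈-tabulate⁻)
open import Data.List.Membership.Propositional.Properties.WithK using (unique∧set⇒bag)
open import Data.List.Relation.Binary.BagAndSetEquality using (∼bag⇒↭)
open import Data.List.Relation.Binary.Permutation.Propositional.Properties using (↭-length)
open import Data.List.Relation.Unary.Unique.Propositional.Properties using (tabulate⁺)
open import Data.Nat using (ℕ; zero; suc; pred; _+_; _*_; _≤_; _<_; z≤n; s≤s; NonZero)
open import Data.Nat.Properties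
  using (_≟_; +-suc; *-suc; suc-pred; n<1+n; m≤n+m; m≤n⇒∃[o]m+o≡n; ≤-trans; <-cmp; <⇒≱)
open import Data.Nat.DivMod using (_%_; _/_; %-congʳ; m≡m%n+[m/n]*n; m%n<n)
open import Data.Nat.Divisibility using (_∣_; divides)
open import Data.Nat.GCD using (gcd; gcd-GCD; gcd[m,n]∣m; gcd[m,n]∣n; module Bézout)
open import Data.Product using (∃; _×_; _,_; proj₁; proj₂; map)
open import Data.Sum using (_⊎_; inj₁; inj₂)
open import Function using (_∘_; id; mk⇔)
open import Level using (0ℓ)
open import Relation.Binary using (Rel; IsDecEquivalence)
open import Relation.Binary.Definitions using (tri<; tri≈; tri>)
open import Relation.Binary.PropositionalEquality
open import Relation.Nullary using (¬_; Dec; yes; no; contradiction)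
open import Relation.Nullary.Decidable using (_×-dec_)
open import Relation.Unary using (Decidable)

least : {P : ℕ → Set} → Decidable P → ∀ {n} → P n → ∃ λ k → P k × (∀ {j} → P j → k ≤ j)
least P? {zero} p = 0 , p , λ _ → z≤n
least P? {suc n} p with P? 0
... | yes p₀ = 0 , p₀ , λ _ → z≤n
... | no ¬p₀ with least (P? ∘ suc) p
...   | k , pk , k-least = suc k , pk , λ
          { {zero} p₀ → contradiction p₀ ¬p₀
          ; {suc j} pj → s≤s (k-least pj) }

leastFin : ∀ {n} {P : Fin n → Set} → Decidable P → ∀ {i} → P i →
           ∃ λ c → P c × (∀ {j} → P j → c ≤ᶠ j)
leastFin P? {i} p with least (λ k → Fin.any? λ j → (toℕ j ≟ k) ×-dec P? j) (i , refl , p)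
... | _ , (c , refl , pc) , c-least = c , pc , λ {j} pj → c-least (j , refl , pj)

module _ {n} {_≈_ : Rel (Fin n) 0ℓ} (≈-isDecEquivalence : IsDecEquivalence _≈_) where
  open IsDecEquivalence ≈-isDecEquivalence
    using () renaming (_≟_ to _≈?_; refl to ≈-refl; sym to ≈-sym; trans to ≈-trans)

  private
    leastRepresentative : ∀ x → ∃ λ c → c ≈ x × (∀ {j} → j ≈ x → c ≤ᶠ j)
    leastRepresentative x = leastFin (_≈? x) ≈-refl

  representative : Fin n → Fin n
  representative x = proj₁ (leastRepresentative x)

  representative-≈ : ∀ x → representative x ≈ x
  representative-≈ x = proj₁ (proj₂ (leastRepresentative x))

  representative-cong : ∀ {x y} → x ≈ y → representative x ≡ representative y
  representative-cong {x} {y} x≈y = Fin.≤-antisym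
    (proj₂ (proj₂ (leastRepresentative x)) (≈-trans (representative-≈ y) (≈-sym x≈y)))
    (proj₂ (proj₂ (leastRepresentative y)) (≈-trans (representative-≈ x) x≈y))

HasSize-unique : ∀ {n} {P Q : Fin n → Set} {a b} → (∀ y → P y ⟺ Q y) →
                 HasSize P a → HasSize Q b → a ≡ b
HasSize-unique P⇔Q (xs , refl , xs! , xs⇔P) (ys , refl , ys! , ys⇔Q) =
  ↭-length (∼bag⇒↭ (unique∧set⇒bag xs! ys! (mk⇔ xs⊆ys ys⊆xs)))
  where
  xs⊆ys : ∀ {y} → y ∈ xs → y ∈ ys
  xs⊆ys {y} = proj₂ (ys⇔Q y) ∘ proj₁ (P⇔Q y) ∘ proj₁ (xs⇔P y)

  ys⊆xs : ∀ {y} → y ∈ ys → y ∈ xs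
  ys⊆xs {y} = proj₂ (xs⇔P y) ∘ proj₂ (P⇔Q y) ∘ proj₁ (ys⇔Q y)

module CyclicSubgroups (G : FinGroup) where
  open FinGroup G
  open ≡-Reasoning

  isGroup : IsGroup _≡_ _·_ e inv
  isGroup = record
    { isMonoid = record
      { isSemigroup = record
        { isMagma = record { isEquivalence = isEquivalence ; ∙-cong = cong₂ _·_ }
        ; assoc = assoc }
      ; identity = idˡ , idʳ }
    ; inverse = invˡ , invʳ
    ; ⁻¹-cong = cong inv }

  group : Group 0ℓ 0ℓ
  group = record { isGroup = isGroup }

  open import Algebra.Properties.Group group using (∙-cancelˡ; inverseʳ-unique; x≈z//y)

  infixr 25 _^_
  _^_ : El G → ℕ → El G
  x ^ n = pow G x n

  ^-distribˡ-+ : ∀ x m n → x ^ (m + n) ≡ x ^ m · x ^ n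
  ^-distribˡ-+ x zero n = sym (idˡ _)
  ^-distribˡ-+ x (suc m) n = trans (cong (x ·_) (^-distribˡ-+ x m n)) (sym (assoc _ _ _))

  ^-*-assoc : ∀ x m n → (x ^ m) ^ n ≡ x ^ (n * m)
  ^-*-assoc x m zero = refl
  ^-*-assoc x m (suc n) = trans (cong (x ^ m ·_) (^-*-assoc x m n)) (sym (^-distribˡ-+ x m (n * m)))

  ^-zeroˡ : ∀ n → e ^ n ≡ e
  ^-zeroˡ zero = refl
  ^-zeroˡ (suc n) = trans (cong (e ·_) (^-zeroˡ n)) (idˡ e)

  ^-identityʳ : ∀ x → x ^ 1 ≡ x
  ^-identityʳ = idʳ

  ^-collision : ∀ x {i j} → i < j → x ^ i ≡ x ^ j → ∃ λ k → suc k ≤ j × x ^ suc k ≡ e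
  ^-collision x {i} i<j xⁱ≡xʲ with m≤n⇒∃[o]m+o≡n i<j
  ... | k , refl = k , s≤s (m≤n+m k i) , sym (∙-cancelˡ (x ^ i) e (x ^ suc k) (begin
    x ^ i · e          ≡⟨ idʳ _ ⟩
    x ^ i              ≡⟨ xⁱ≡xʲ ⟩
    x ^ (suc i + k)    ≡⟨ cong (x ^_) (+-suc i k) ⟨
    x ^ (i + suc k)    ≡⟨ ^-distribˡ-+ x i (suc k) ⟩
    x ^ i · x ^ suc k  ∎))

  opaque
    private
      period-exists : ∀ x → ∃ λ k → x ^ suc k ≡ e
      period-exists x with Fin.pigeonhole (n<1+n order) (λ i → x ^ toℕ i)
      ... | i , j , i<j , xⁱ≡xʲ with ^-collision x {toℕ i} {toℕ j} i<j xⁱ≡xʲ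
      ...   | k , _ , xᵏ⁺¹≡e = k , xᵏ⁺¹≡e

      leastPeriod : ∀ x → ∃ λ k → x ^ suc k ≡ e × (∀ {j} → x ^ suc j ≡ e → k ≤ j)
      leastPeriod x with k , xᵏ⁺¹≡e ← period-exists x =
        least (λ k → x ^ suc k Fin.≟ e) {k} xᵏ⁺¹≡e

    ord : El G → ℕ
    ord x = suc (proj₁ (leastPeriod x))

    instance
      ord-nonZero : ∀ {x} → NonZero (ord x)
      ord-nonZero = _

    ^-ord : ∀ x → x ^ ord x ≡ e
    ^-ord x = proj₁ (proj₂ (leastPeriod x))

    ord-minimal : ∀ x {k} → x ^ suc k ≡ e → ord x ≤ suc k
    ord-minimal x xᵏ⁺¹≡e = s≤s (proj₂ (proj₂ (leastPeriod x)) xᵏ⁺¹≡e)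

  ^-collision⇒ord≤ : ∀ x {i j} → i < j → x ^ i ≡ x ^ j → ord x ≤ j
  ^-collision⇒ord≤ x i<j xⁱ≡xʲ with ^-collision x i<j xⁱ≡xʲ
  ... | k , k<j , xᵏ⁺¹≡e = ≤-trans (ord-minimal x xᵏ⁺¹≡e) k<j

  ^-injective : ∀ x {i j} → i < ord x → j < ord x → x ^ i ≡ x ^ j → i ≡ j
  ^-injective x {i} {j} i<o j<o xⁱ≡xʲ with <-cmp i j
  ... | tri< i<j _ _ = contradiction (^-collision⇒ord≤ x i<j xⁱ≡xʲ) (<⇒≱ j<o)
  ... | tri≈ _ i≡j _ = i≡j
  ... | tri> _ _ j<i = contradiction (^-collision⇒ord≤ x j<i (sym xⁱ≡xʲ)) (<⇒≱ i<o)

  ^-mod : ∀ x n → x ^ n ≡ x ^ (n % ord x)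
  ^-mod x n = begin
    x ^ n                      ≡⟨ cong (x ^_) (m≡m%n+[m/n]*n n (ord x)) ⟩
    x ^ (n % ord x + q * ord x) ≡⟨ ^-distribˡ-+ x (n % ord x) (q * ord x) ⟩
    x ^ (n % ord x) · x ^ (q * ord x) ≡⟨ cong (x ^ (n % ord x) ·_) (^-*-assoc x (ord x) q) ⟨
    x ^ (n % ord x) · (x ^ ord x) ^ q ≡⟨ cong (λ y → x ^ (n % ord x) · y ^ q) (^-ord x) ⟩
    x ^ (n % ord x) · e ^ q    ≡⟨ cong (x ^ (n % ord x) ·_) (^-zeroˡ q) ⟩
    x ^ (n % ord x) · e        ≡⟨ idʳ _ ⟩
    x ^ (n % ord x)            ∎
    where q = n / ord x

  ^≡^⇔% : ∀ x m n → (x ^ m ≡ x ^ n) ⟺ (m % ord x ≡ n % ord x)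
  ^≡^⇔% x m n =
    (λ xᵐ≡xⁿ → ^-injective x (m%n<n m (ord x)) (m%n<n n (ord x))
                 (trans (sym (^-mod x m)) (trans xᵐ≡xⁿ (^-mod x n)))) ,
    (λ m≡n → trans (^-mod x m) (trans (cong (x ^_) m≡n) (sym (^-mod x n))))

  Gen-⊆ : ∀ {S T : El G → Set} → (∀ {a} → S a → Gen G T a) → ∀ {w} → Gen G S w → Gen G T w
  Gen-⊆ S⊆T gen-e = gen-e
  Gen-⊆ S⊆T (gen-s s) = S⊆T s
  Gen-⊆ S⊆T (gen-mul p q) = gen-mul (Gen-⊆ S⊆T p) (Gen-⊆ S⊆T q)
  Gen-⊆ S⊆T (gen-inv p) = gen-inv (Gen-⊆ S⊆T p)

  Gen-^ : ∀ {S w} → Gen G S w → ∀ n → Gen G S (w ^ n)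
  Gen-^ w∈ zero = gen-e
  Gen-^ w∈ (suc n) = gen-mul w∈ (Gen-^ w∈ n)

  ^∈Cyc : ∀ x n → Cyc G x (x ^ n)
  ^∈Cyc x = Gen-^ (gen-s refl)

  inv-^ : ∀ x n → inv (x ^ n) ≡ x ^ (n * pred (ord x))
  inv-^ x n = sym (inverseʳ-unique (x ^ n) _ (begin
    x ^ n · x ^ (n * pred (ord x))  ≡⟨ ^-distribˡ-+ x n (n * pred (ord x)) ⟨
    x ^ (n + n * pred (ord x))      ≡⟨ cong (x ^_) (*-suc n (pred (ord x))) ⟨
    x ^ (n * suc (pred (ord x)))    ≡⟨ cong (λ o → x ^ (n * o)) (suc-pred (ord x)) ⟩
    x ^ (n * ord x)                 ≡⟨ ^-*-assoc x (ord x) n ⟨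
    (x ^ ord x) ^ n                 ≡⟨ cong (_^ n) (^-ord x) ⟩
    e ^ n                           ≡⟨ ^-zeroˡ n ⟩
    e                               ∎))

  Cyc⇒^ : ∀ {x w} → Cyc G x w → ∃ λ n → w ≡ x ^ n
  Cyc⇒^ gen-e = 0 , refl
  Cyc⇒^ {x} (gen-s refl) = 1 , sym (^-identityʳ x)
  Cyc⇒^ {x} (gen-mul p q) with m , refl ← Cyc⇒^ p | n , refl ← Cyc⇒^ q =
    m + n , sym (^-distribˡ-+ x m n)
  Cyc⇒^ {x} (gen-inv p) with n , refl ← Cyc⇒^ p = n * pred (ord x) , inv-^ x n

  Cyc⇒^< : ∀ {x w} → Cyc G x w → ∃ λ n → n < ord x × w ≡ x ^ n
  Cyc⇒^< {x} w∈⟨x⟩ with n , refl ← Cyc⇒^ w∈⟨x⟩ = n % ord x , m%n<n n (ord x) , ^-mod x n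

  infix 4 _⊑_ _~_

  _⊑_ : El G → El G → Set
  _⊑_ = Defs._⊑_ G

  ⊑⇒Cyc : ∀ {x y} → x ⊑ y → Cyc G y x
  ⊑⇒Cyc x⊑y = x⊑y _ (gen-s refl)

  Cyc⇒⊑ : ∀ {x y} → Cyc G y x → x ⊑ y
  Cyc⇒⊑ x∈⟨y⟩ _ = Gen-⊆ λ { refl → x∈⟨y⟩ }

  ⊑-refl : ∀ {x} → x ⊑ x
  ⊑-refl _ = id

  ⊑-trans : ∀ {x y z} → x ⊑ y → y ⊑ z → x ⊑ z
  ⊑-trans x⊑y y⊑z w = y⊑z w ∘ x⊑y w

  _~_ : El G → El G → Set
  x ~ y = x ⊑ y × y ⊑ x

  ⊑-resp-~ : ∀ {x x′ y y′} → x ~ x′ → y ~ y′ → x ⊑ y → x′ ⊑ y′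
  ⊑-resp-~ (_ , x′⊑x) (y⊑y′ , _) x⊑y = ⊑-trans x′⊑x (⊑-trans x⊑y y⊑y′)

  _⊑?_ : ∀ x y → Dec (x ⊑ y)
  x ⊑? y with Fin.any? (λ (i : Fin (ord y)) → x Fin.≟ y ^ toℕ i)
  ... | yes (i , x≡yⁱ) = yes (Cyc⇒⊑ (subst (Cyc G y) (sym x≡yⁱ) (^∈Cyc y (toℕ i))))
  ... | no ∄i = no λ x⊑y → let n , n<o , x≡yⁿ = Cyc⇒^< (⊑⇒Cyc x⊑y) in
    ∄i (fromℕ< n<o , trans x≡yⁿ (cong (y ^_) (sym (Fin.toℕ-fromℕ< n<o))))

  ~-isDecEquivalence : IsDecEquivalence _~_
  ~-isDecEquivalence = record
    { isEquivalence = record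
      { refl = ⊑-refl , ⊑-refl
      ; sym = λ (x⊑y , y⊑x) → y⊑x , x⊑y
      ; trans = λ (x⊑y , y⊑x) (y⊑z , z⊑y) → ⊑-trans x⊑y y⊑z , ⊑-trans z⊑y y⊑x }
    ; _≟_ = λ x y → (x ⊑? y) ×-dec (y ⊑? x) }

  open IsDecEquivalence ~-isDecEquivalence public
    using () renaming (sym to ~-sym; trans to ~-trans)

  ~⇒Cyc⇔ : ∀ {x y} → x ~ y → ∀ w → Cyc G x w ⟺ Cyc G y w
  ~⇒Cyc⇔ (x⊑y , y⊑x) w = x⊑y w , y⊑x w

  Cyc⇔⇒~ : ∀ {x y} → (∀ w → Cyc G x w ⟺ Cyc G y w) → x ~ y
  Cyc⇔⇒~ ⟨x⟩⇔⟨y⟩ = (λ w → proj₁ (⟨x⟩⇔⟨y⟩ w)) , (λ w → proj₂ (⟨x⟩⇔⟨y⟩ w))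

  Cyc-size : ∀ x → HasSize (Cyc G x) (ord x)
  Cyc-size x = tabulate powers , length-tabulate powers , tabulate⁺ powers-injective ,
               λ w → ∈⇒Cyc , Cyc⇒∈
    where
    powers : Fin (ord x) → El G
    powers i = x ^ toℕ i

    powers-injective : ∀ {i j} → powers i ≡ powers j → i ≡ j
    powers-injective = Fin.toℕ-injective ∘ ^-injective x (Fin.toℕ<n _) (Fin.toℕ<n _)

    ∈⇒Cyc : ∀ {w} → w ∈ tabulate powers → Cyc G x w
    ∈⇒Cyc w∈ with i , refl ← ∈-tabulate⁻ {f = powers} w∈ = ^∈Cyc x (toℕ i)

    Cyc⇒∈ : ∀ {w} → Cyc G x w → w ∈ tabulate powers
    Cyc⇒∈ w∈⟨x⟩ with n , n<o , refl ← Cyc⇒^< w∈⟨x⟩ =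
      subst (_∈ tabulate powers) (cong (x ^_) (Fin.toℕ-fromℕ< n<o))
        (∈-tabulate⁺ {f = powers} (fromℕ< n<o))

  ord-unique : ∀ {x n} → HasSize (Cyc G x) n → n ≡ ord x
  ord-unique ⟨x⟩-size = HasSize-unique (λ _ → id , id) ⟨x⟩-size (Cyc-size _)

  ord-cong : ∀ {x y} → x ~ y → ord x ≡ ord y
  ord-cong x~y = HasSize-unique (~⇒Cyc⇔ x~y) (Cyc-size _) (Cyc-size _)

  Gen2-^⇔Cyc-^-gcd : ∀ z a b w → Gen2 G (z ^ a) (z ^ b) w ⟺ Cyc G (z ^ gcd a b) w
  Gen2-^⇔Cyc-^-gcd z a b w =
    Gen-⊆ generators∈ , Gen-⊆ λ { refl → gcd∈ (Bézout.identity (gcd-GCD a b)) }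
    where
    d : ℕ
    d = gcd a b

    multiple∈ : ∀ {n} → d ∣ n → Cyc G (z ^ d) (z ^ n)
    multiple∈ (divides q refl) = subst (Cyc G (z ^ d)) (^-*-assoc z d q) (^∈Cyc (z ^ d) q)

    generators∈ : ∀ {y} → (y ≡ z ^ a) ⊎ (y ≡ z ^ b) → Cyc G (z ^ d) y
    generators∈ (inj₁ refl) = multiple∈ (gcd[m,n]∣m a b)
    generators∈ (inj₂ refl) = multiple∈ (gcd[m,n]∣n a b)

    multipleˡ∈ : ∀ s → Gen2 G (z ^ a) (z ^ b) (z ^ (s * a))
    multipleˡ∈ s = subst (Gen2 G (z ^ a) (z ^ b)) (^-*-assoc z a s) (Gen-^ (gen-s (inj₁ refl)) s)

    multipleʳ∈ : ∀ t → Gen2 G (z ^ a) (z ^ b) (z ^ (t * b))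
    multipleʳ∈ t = subst (Gen2 G (z ^ a) (z ^ b)) (^-*-assoc z b t) (Gen-^ (gen-s (inj₂ refl)) t)

    z^d≡z^n//z^m : ∀ {m n} → d + m ≡ n → z ^ d ≡ z ^ n · inv (z ^ m)
    z^d≡z^n//z^m {m} d+m≡n =
      x≈z//y (z ^ d) (z ^ m) _ (trans (sym (^-distribˡ-+ z d m)) (cong (z ^_) d+m≡n))

    gcd∈ : Bézout.Identity d a b → Gen2 G (z ^ a) (z ^ b) (z ^ d)
    gcd∈ (Bézout.+- s t d+tb≡sa) = subst (Gen2 G (z ^ a) (z ^ b)) (sym (z^d≡z^n//z^m d+tb≡sa))
      (gen-mul (multipleˡ∈ s) (gen-inv (multipleʳ∈ t)))
    gcd∈ (Bézout.-+ s t d+sa≡tb) = subst (Gen2 G (z ^ a) (z ^ b)) (sym (z^d≡z^n//z^m d+sa≡tb))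
      (gen-mul (multipleʳ∈ t) (gen-inv (multipleˡ∈ s)))

  UpperBounded : El G → El G → Set
  UpperBounded x y = ∃ λ z → x ⊑ z × y ⊑ z

  Incomparable : El G → El G → Set
  Incomparable x y = ¬ x ⊑ y × ¬ y ⊑ x

  Gen2-cyclic⇔upperBounded : ∀ {x y} → IsCyclic G (Gen2 G x y) ⟺ UpperBounded x y
  Gen2-cyclic⇔upperBounded = to , from
    where
    to : ∀ {x y} → IsCyclic G (Gen2 G x y) → UpperBounded x y
    to (z , ⟨x,y⟩⇔⟨z⟩) = z , Cyc⇒⊑ (proj₁ (⟨x,y⟩⇔⟨z⟩ _) (gen-s (inj₁ refl)))
                           , Cyc⇒⊑ (proj₁ (⟨x,y⟩⇔⟨z⟩ _) (gen-s (inj₂ refl)))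

    from : ∀ {x y} → UpperBounded x y → IsCyclic G (Gen2 G x y)
    from (z , x⊑z , y⊑z) with a , refl ← Cyc⇒^ (⊑⇒Cyc x⊑z) | b , refl ← Cyc⇒^ (⊑⇒Cyc y⊑z) =
      z ^ gcd a b , Gen2-^⇔Cyc-^-gcd z a b

  power⇔⊑ : ∀ {x y} → (∃ λ n → y ≡ x ^ n) ⟺ (y ⊑ x)
  power⇔⊑ = (λ { (n , refl) → Cyc⇒⊑ (^∈Cyc _ n) }) , Cyc⇒^ ∘ ⊑⇒Cyc

  DAdj⇔upperBounded×incomparable : ∀ {x y} → DAdj G x y ⟺ (UpperBounded x y × Incomparable x y)
  DAdj⇔upperBounded×incomparable = to , from
    where
    to : ∀ {x y} → DAdj G x y → UpperBounded x y × Incomparable x y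
    to ((x≢y , ⟨x,y⟩-cyclic) , ¬pow) =
      proj₁ Gen2-cyclic⇔upperBounded ⟨x,y⟩-cyclic ,
      (λ x⊑y → ¬pow (x≢y , inj₂ (proj₂ power⇔⊑ x⊑y))) ,
      (λ y⊑x → ¬pow (x≢y , inj₁ (proj₂ power⇔⊑ y⊑x)))

    from : ∀ {x y} → UpperBounded x y × Incomparable x y → DAdj G x y
    from (bounded , x⋢y , y⋢x) =
      ((λ { refl → x⋢y ⊑-refl }) , proj₂ Gen2-cyclic⇔upperBounded bounded) ,
      λ { (_ , inj₁ y-power) → y⋢x (proj₁ power⇔⊑ y-power)
        ; (_ , inj₂ x-power) → x⋢y (proj₁ power⇔⊑ x-power) }

  opaque
    generator : El G → El G
    generator = representative ~-isDecEquivalence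

    generator-~ : ∀ w → generator w ~ w
    generator-~ = representative-≈ ~-isDecEquivalence

    generator-cong : ∀ {w w′} → w ~ w′ → generator w ≡ generator w′
    generator-cong = representative-cong ~-isDecEquivalence

    private
      logSpec : ∀ w → ∃ λ n → n < ord (generator w) × w ≡ generator w ^ n
      logSpec w = Cyc⇒^< (⊑⇒Cyc (proj₂ (generator-~ w)))

    log : El G → ℕ
    log w = proj₁ (logSpec w)

    log<ord : ∀ w → log w < ord (generator w)
    log<ord w = proj₁ (proj₂ (logSpec w))

    ^-log : ∀ w → generator w ^ log w ≡ w
    ^-log w = sym (proj₂ (proj₂ (logSpec w)))

  log-unique : ∀ {w n} → n < ord (generator w) → generator w ^ n ≡ w → log w ≡ n
  log-unique n<o gⁿ≡w = ^-injective _ (log<ord _) n<o (trans (^-log _) (sym gⁿ≡w))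

  ^~⇔invertible : ∀ x n → (x ^ n ~ x) ⟺ (∃ λ m → (m * n) % ord x ≡ 1 % ord x)
  ^~⇔invertible x n = to , from
    where
    to : x ^ n ~ x → ∃ λ m → (m * n) % ord x ≡ 1 % ord x
    to (_ , x⊑xⁿ) with m , x≡xⁿᵐ ← Cyc⇒^ (⊑⇒Cyc x⊑xⁿ) = m , proj₁ (^≡^⇔% x (m * n) 1) (begin
      x ^ (m * n)    ≡⟨ ^-*-assoc x n m ⟨
      (x ^ n) ^ m    ≡⟨ x≡xⁿᵐ ⟨
      x              ≡⟨ ^-identityʳ x ⟨
      x ^ 1          ∎)

    from : (∃ λ m → (m * n) % ord x ≡ 1 % ord x) → x ^ n ~ x
    from (m , mn≡1) =
      Cyc⇒⊑ (^∈Cyc x n) , Cyc⇒⊑ (subst (Cyc G (x ^ n)) xⁿᵐ≡x (^∈Cyc (x ^ n) m))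
      where
      xⁿᵐ≡x : (x ^ n) ^ m ≡ x
      xⁿᵐ≡x = begin
        (x ^ n) ^ m    ≡⟨ ^-*-assoc x n m ⟩
        x ^ (m * n)    ≡⟨ proj₂ (^≡^⇔% x (m * n) 1) mn≡1 ⟩
        x ^ 1          ≡⟨ ^-identityʳ x ⟩
        x              ∎

module _ (G H : FinGroup) where
  private
    module G = CyclicSubgroups G
    module H = CyclicSubgroups H

  Preserves-~ : (El G → El H) → Set
  Preserves-~ α = ∀ {x y} → x G.~ y → α x H.~ α y

  Preserves-ord : (El G → El H) → Set
  Preserves-ord α = ∀ x → H.ord (α x) ≡ G.ord x

  ^~-transfer : ∀ {c d n} → G.ord c ≡ H.ord d → c G.^ n G.~ c → d H.^ n H.~ d
  ^~-transfer {c} {d} {n} ord-c≡ord-d c^n~c with m , mn≡1 ← proj₁ (G.^~⇔invertible c n) c^n~c =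
    proj₂ (H.^~⇔invertible d n)
      (m , trans (%-congʳ (sym ord-c≡ord-d)) (trans mn≡1 (%-congʳ ord-c≡ord-d)))

  transport : (El G → El H) → El G → El H
  transport α w = H.generator (α (G.generator w)) H.^ G.log w

  ord-generator : ∀ {α} → Preserves-ord α → ∀ c → H.ord (H.generator (α c)) ≡ G.ord c
  ord-generator {α} α-ord c = trans (H.ord-cong (H.generator-~ (α c))) (α-ord c)

  transport-~generator : ∀ {α} → Preserves-ord α →
                         ∀ w → transport α w H.~ H.generator (α (G.generator w))
  transport-~generator α-ord w = ^~-transfer {n = G.log w}
    (sym (ord-generator α-ord (G.generator w)))
    (subst (G._~ G.generator w) (sym (G.^-log w)) (G.~-sym (G.generator-~ w)))

  transport-~ : ∀ {α} → Preserves-~ α → Preserves-ord α → ∀ w → transport α w H.~ α w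
  transport-~ α-cong α-ord w = H.~-trans (transport-~generator α-ord w)
    (H.~-trans (H.generator-~ _) (α-cong (G.generator-~ w)))

  DAdj-preserved : (f : El G → El H) → (∀ x y → (x G.⊑ y) ⟺ (f x H.⊑ f y)) →
                   (∀ z → ∃ λ x → f x H.~ z) → ∀ x y → DAdj G x y ⟺ DAdj H (f x) (f y)
  DAdj-preserved f f-⊑⇔ f-onto x y =
    proj₂ H.DAdj⇔upperBounded×incomparable ∘ map upperBounded→ incomparable→ ∘
      proj₁ G.DAdj⇔upperBounded×incomparable ,
    proj₂ G.DAdj⇔upperBounded×incomparable ∘ map upperBounded← incomparable← ∘
      proj₁ H.DAdj⇔upperBounded×incomparable
    where
    upperBounded→ : G.UpperBounded x y → H.UpperBounded (f x) (f y)
    upperBounded→ (z , x⊑z , y⊑z) = f z , proj₁ (f-⊑⇔ x z) x⊑z , proj₁ (f-⊑⇔ y z) y⊑z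

    upperBounded← : H.UpperBounded (f x) (f y) → G.UpperBounded x y
    upperBounded← (z , fx⊑z , fy⊑z) with z′ , fz′~z ← f-onto z =
      z′ , proj₂ (f-⊑⇔ x z′) (H.⊑-trans fx⊑z (proj₂ fz′~z))
         , proj₂ (f-⊑⇔ y z′) (H.⊑-trans fy⊑z (proj₂ fz′~z))

    incomparable→ : G.Incomparable x y → H.Incomparable (f x) (f y)
    incomparable→ = map (_∘ proj₂ (f-⊑⇔ x y)) (_∘ proj₂ (f-⊑⇔ y x))

    incomparable← : H.Incomparable (f x) (f y) → G.Incomparable x y
    incomparable← = map (_∘ proj₁ (f-⊑⇔ x y)) (_∘ proj₁ (f-⊑⇔ y x))

module _ (G H : FinGroup) where
  private
    module G = CyclicSubgroups G
    module H = CyclicSubgroups H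

  transport-inverse : ∀ {α : El G → El H} {β : El H → El G} →
                      Preserves-ord G H α → Preserves-~ H G β → (∀ x → β (α x) G.~ x) →
                      ∀ w → transport H G β (transport G H α w) ≡ w
  transport-inverse {α} {β} α-ord β-cong βα~id w = begin
    G.generator (β (H.generator v)) G.^ H.log v  ≡⟨ cong₂ G._^_ generator-back log-v ⟩
    G.generator w G.^ G.log w                    ≡⟨ G.^-log w ⟩
    w                                            ∎
    where
    open ≡-Reasoning
    c : El G
    c = G.generator w

    v : El H
    v = transport G H α w

    v~αc : v H.~ α c
    v~αc = H.~-trans (transport-~generator G H α-ord w) (H.generator-~ (α c))

    generator-v : H.generator v ≡ H.generator (α c)
    generator-v = H.generator-cong v~αc

    log-v : H.log v ≡ G.log w
    log-v = H.log-unique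
      (subst (G.log w <_) (sym (trans (cong H.ord generator-v) (ord-generator G H α-ord c))) (G.log<ord w))
      (cong (H._^ G.log w) generator-v)

    generator-back : G.generator (β (H.generator v)) ≡ c
    generator-back = G.generator-cong
      (G.~-trans (β-cong (H.~-trans (H.generator-~ v) v~αc)) (G.~-trans (βα~id c) (G.generator-~ w)))

module FromLcIso {G H : FinGroup} (I : LcIso G H) where
  open LcIso I
  private
    module G = CyclicSubgroups G
    module H = CyclicSubgroups H

  φ-~ : Preserves-~ G H φ
  φ-~ (x⊑y , y⊑x) = proj₁ (φ-mono _ _) x⊑y , proj₁ (φ-mono _ _) y⊑x

  φ-~⁻¹ : ∀ {x y} → φ x H.~ φ y → x G.~ y
  φ-~⁻¹ (φx⊑φy , φy⊑φx) = proj₂ (φ-mono _ _) φx⊑φy , proj₂ (φ-mono _ _) φy⊑φx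

  φ-ord : Preserves-ord G H φ
  φ-ord x = sym (H.ord-unique (proj₁ (φ-label x (G.ord x)) (G.Cyc-size x)))

  ψφ~id : ∀ x → ψ (φ x) G.~ x
  ψφ~id x = G.Cyc⇔⇒~ (ψφ x)

  φψ~id : ∀ y → φ (ψ y) H.~ y
  φψ~id y = H.Cyc⇔⇒~ (φψ y)

  ψ-~ : Preserves-~ H G ψ
  ψ-~ x~y = φ-~⁻¹ (H.~-trans (φψ~id _) (H.~-trans x~y (H.~-sym (φψ~id _))))

  ψ-ord : Preserves-ord H G ψ
  ψ-ord y = trans (sym (φ-ord (ψ y))) (H.ord-cong (φψ~id y))

  f : El G → El H
  f = transport G H φ

  g : El H → El G
  g = transport H G ψ

  f~φ : ∀ x → f x H.~ φ x
  f~φ = transport-~ G H φ-~ φ-ord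

  f-⊑⇔ : ∀ x y → (x G.⊑ y) ⟺ (f x H.⊑ f y)
  f-⊑⇔ x y =
    (λ x⊑y → H.⊑-resp-~ (H.~-sym (f~φ x)) (H.~-sym (f~φ y)) (proj₁ (φ-mono x y) x⊑y)) ,
    (λ fx⊑fy → proj₂ (φ-mono x y) (H.⊑-resp-~ (f~φ x) (f~φ y) fx⊑fy))

  f-DAdj : ∀ x y → DAdj G x y ⟺ DAdj H (f x) (f y)
  f-DAdj = DAdj-preserved G H f f-⊑⇔ λ z → ψ z , H.~-trans (f~φ (ψ z)) (φψ~id z)

  gf≡id : ∀ x → g (f x) ≡ x
  gf≡id = transport-inverse G H φ-ord ψ-~ ψφ~id

  fg≡id : ∀ y → f (g y) ≡ y
  fg≡id = transport-inverse H G ψ-ord φ-~ φψ~id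

corollary1 : (G H : FinGroup) → LcIso G H → DIso G H
corollary1 G H I = record
  { f = f
  ; g = g
  ; f-vert = λ x (y , x—y) → f y , proj₁ (f-DAdj x y) x—y
  ; g-vert = λ y (y′ , y—y′) → g y′ ,
      proj₂ (f-DAdj (g y) (g y′)) (subst₂ (DAdj H) (sym (fg≡id y)) (sym (fg≡id y′)) y—y′)
  ; gf = λ x _ → gf≡id x
  ; fg = λ y _ → fg≡id y
  ; f-adj = λ x y _ _ → f-DAdj x y
  }
  where open FromLcIso I
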